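{- For every positive integer $n$, $$\sum_{k=0}^{n-1}\frac{1}{2k+1}=\sum_{k=1}^n(-2)^{k-1}\binom{n}{k}\frac{(k-1)!}{(2k-1)!!}.$$
   Context: $(2k-1)!!=1\cdot3\cdot5\cdots(2k-1)$. -}

module Defs where

open import Data.Nat as ℕ using (ℕ; zero; suc; NonZero)
open import Data.Nat.Combinatorics using (_C_)
open import Data.Nat.Base using (_!)
open import Data.Nat.Properties using (m*n≢0)
open import Data.Integer as ℤ using (ℤ; +_)
open import Data.Rational as ℚ using (ℚ; 0ℚ; _/_)

sumℚ : ℕ → (ℕ → ℚ) → ℚ
sumℚ zero    f = 0ℚ
sumℚ (suc n) f = sumℚ n f ℚ.+ f n

odd : ℕ → ℕ
odd k = suc (2 ℕ.* k)

-- oddDoubleFact k = (2k-1)!! = 1·3·5···(2k-1)   (empty product 1 for k = 0)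
oddDoubleFact : ℕ → ℕ
oddDoubleFact zero    = 1
oddDoubleFact (suc k) = oddDoubleFact k ℕ.* odd k

oddDoubleFact-nonZero : ∀ k → NonZero (oddDoubleFact k)
oddDoubleFact-nonZero zero    = _
oddDoubleFact-nonZero (suc k) =
  m*n≢0 (oddDoubleFact k) (odd k) {{oddDoubleFact-nonZero k}}

negTwoPow : ℕ → ℤ
negTwoPow m = (ℤ.- (+ 2)) ℤ.^ m

-- the k-th summand of the right-hand side, for k ≥ 1 written k = suc j:
-- (-2)^(k-1) · C(n,k) · (k-1)! / (2k-1)!!
rhsTerm : ℕ → ℕ → ℚ
rhsTerm n j =
  (negTwoPow j ℤ.* + (n C suc j) ℤ.* + (j !))
    / oddDoubleFact (suc j)
  where instance _ = oddDoubleFact-nonZero (suc j)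

lhs : ℕ → ℚ
lhs n = sumℚ n (λ k → + 1 / odd k)

rhs : ℕ → ℚ
rhs n = sumℚ n (rhsTerm n)

-- Write I n m = 2^m m! (2n-1)!! / (2n+2m+1)!!, which is ∫₀¹ x^{2n} (1 - x²)^m dx, and
-- J n m = (-1)^m I n m = ∫₀¹ x^{2n} (x² - 1)^m dx. Splitting x^{2n+2} = x^{2n} ((x² - 1) + 1)
-- gives the Pascal recurrence J (n+1) m = J n m + J n (m+1), hence Σ_k C(n,k) J 0 k = J n 0
-- = 1/(2n+1) (the binomial expansion of x^{2n} = ((x² - 1) + 1)^n). The k-th summand on the
-- right is C(n,k) J 0 (k-1), so by Pascal's rule the right side increases from n to n+1 by
-- exactly Σ_k C(n,k) J 0 k = 1/(2n+1), as does the left side.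
module Submission where

open import Defs
open import Algebra.Bundles using (CommutativeMonoid)
open import Data.Empty using (⊥-elim)
open import Data.Integer as ℤ using (+_; -1ℤ)
import Data.Integer.Properties as ℤ
import Data.Integer.Tactic.RingSolver as ℤ-Solver
open import Data.Nat as ℕ using (ℕ; _≥_; zero; suc; NonZero; _!; _^_)
import Data.Nat.Properties as ℕ
import Data.Nat.Tactic.RingSolver as ℕ-Solver
open import Data.Nat.Combinatorics using (_C_; k>n⇒nCk≡0; nCk+nC[k+1]≡[n+1]C[k+1])
open import Data.Rational as ℚ using (ℚ; 0ℚ; 1ℚ; _/_; toℚᵘ)
import Data.Rational.Properties as ℚ
open import Data.Rational.Solver using (module +-*-Solver)
open import Data.Rational.Unnormalised as ℚᵘ using (mkℚᵘ; _≃_)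
import Data.Rational.Unnormalised.Properties as ℚᵘ
open import Function using (_∘_)
open import Relation.Binary.PropositionalEquality
  using (_≡_; refl; sym; trans; cong; cong₂; module ≡-Reasoning)
open import Algebra.Properties.CommutativeSemigroup
  (CommutativeMonoid.commutativeSemigroup ℚ.+-0-commutativeMonoid) using (interchange; x∙yz≈xz∙y)

private
  nonZero-0 : ∀ {A : Set} .{{_ : NonZero 0}} → A
  nonZero-0 = ⊥-elim (ℕ.≢-nonZero⁻¹ 0 refl)

  toℚᵘ-/ : ∀ p a → toℚᵘ (p / suc a) ≃ mkℚᵘ p a
  toℚᵘ-/ p a = ℚ.toℚᵘ-fromℚᵘ (mkℚᵘ p a)

/-cross : ∀ p q {d e} .{{_ : NonZero d}} .{{_ : NonZero e}} →
          p ℤ.* + e ≡ q ℤ.* + d → p / d ≡ q / e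
/-cross p q {suc a} {suc b} eq = ℚ.fromℚᵘ-cong {mkℚᵘ p a} {mkℚᵘ q b} (ℚᵘ.*≡* eq)
/-cross p q {zero}          _  = nonZero-0
/-cross p q {suc _} {zero}  _  = nonZero-0

/-+-/ : ∀ p q d e .{{_ : NonZero d}} .{{_ : NonZero e}} →
        (p / d) ℚ.+ (q / e) ≡ ((p ℤ.* + e ℤ.+ q ℤ.* + d) / (d ℕ.* e)) {{ℕ.m*n≢0 d e}}
/-+-/ p q (suc a) (suc b) = ℚ.toℚᵘ-injective (ℚᵘ.≃-trans
  (ℚ.toℚᵘ-homo-+ (p / suc a) (q / suc b))
  (ℚᵘ.≃-trans (ℚᵘ.+-cong (toℚᵘ-/ p a) (toℚᵘ-/ q b)) (ℚᵘ.≃-sym (toℚᵘ-/ _ _))))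
/-+-/ p q zero    _       = nonZero-0
/-+-/ p q (suc _) zero    = nonZero-0

/-*-/ : ∀ p q d e .{{_ : NonZero d}} .{{_ : NonZero e}} →
        (p / d) ℚ.* (q / e) ≡ ((p ℤ.* q) / (d ℕ.* e)) {{ℕ.m*n≢0 d e}}
/-*-/ p q (suc a) (suc b) = ℚ.toℚᵘ-injective (ℚᵘ.≃-trans
  (ℚ.toℚᵘ-homo-* (p / suc a) (q / suc b))
  (ℚᵘ.≃-trans (ℚᵘ.*-cong (toℚᵘ-/ p a) (toℚᵘ-/ q b)) (ℚᵘ.≃-sym (toℚᵘ-/ _ _))))
/-*-/ p q zero    _       = nonZero-0
/-*-/ p q (suc _) zero    = nonZero-0

ℕ/-cross : ∀ a b d e .{{_ : NonZero d}} .{{_ : NonZero e}} →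
           a ℕ.* e ≡ b ℕ.* d → + a / d ≡ + b / e
ℕ/-cross a b d e eq = /-cross (+ a) (+ b) (begin
  + a ℤ.* + e    ≡⟨ ℤ.pos-* a e ⟨
  + (a ℕ.* e)    ≡⟨ cong +_ eq ⟩
  + (b ℕ.* d)    ≡⟨ ℤ.pos-* b d ⟩
  + b ℤ.* + d    ∎)
  where open ≡-Reasoning

ℕ/-+-/ : ∀ a b d e .{{_ : NonZero d}} .{{_ : NonZero e}} →
         (+ a / d) ℚ.+ (+ b / e) ≡ (+ (a ℕ.* e ℕ.+ b ℕ.* d) / (d ℕ.* e)) {{ℕ.m*n≢0 d e}}
ℕ/-+-/ a b d e = trans (/-+-/ (+ a) (+ b) d e) (ℚ./-cong (begin
  + a ℤ.* + e ℤ.+ + b ℤ.* + d      ≡⟨ cong₂ ℤ._+_ (ℤ.pos-* a e) (ℤ.pos-* b d) ⟨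
  + (a ℕ.* e) ℤ.+ + (b ℕ.* d)      ≡⟨ ℤ.pos-+ (a ℕ.* e) (b ℕ.* d) ⟨
  + (a ℕ.* e ℕ.+ b ℕ.* d)          ∎) refl)
  where
  open ≡-Reasoning
  instance _ = ℕ.m*n≢0 d e

ℕ/-distrib-+ : ∀ a b d .{{_ : NonZero d}} → + (a ℕ.+ b) / d ≡ (+ a / d) ℚ.+ (+ b / d)
ℕ/-distrib-+ a b d = sym (trans (ℕ/-+-/ a b d d)
  (ℕ/-cross (a ℕ.* d ℕ.+ b ℕ.* d) (a ℕ.+ b) (d ℕ.* d) d (rearrange a b d)))
  where
  instance _ = ℕ.m*n≢0 d d
  rearrange : ∀ a b d → (a ℕ.* d ℕ.+ b ℕ.* d) ℕ.* d ≡ (a ℕ.+ b) ℕ.* (d ℕ.* d)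
  rearrange = ℕ-Solver.solve-∀

ℕ/-cancelʳ-* : ∀ a k d .{{_ : NonZero d}} .{{_ : NonZero k}} →
               (+ (a ℕ.* k) / (d ℕ.* k)) {{ℕ.m*n≢0 d k}} ≡ + a / d
ℕ/-cancelʳ-* a k d = ℕ/-cross (a ℕ.* k) a (d ℕ.* k) d (rearrange a k d)
  where
  instance _ = ℕ.m*n≢0 d k
  rearrange : ∀ a k d → a ℕ.* k ℕ.* d ≡ a ℕ.* (d ℕ.* k)
  rearrange = ℕ-Solver.solve-∀

sumℚ-cong : ∀ L {f g : ℕ → ℚ} → (∀ k → f k ≡ g k) → sumℚ L f ≡ sumℚ L g
sumℚ-cong zero    f≗g = refl
sumℚ-cong (suc L) f≗g = cong₂ ℚ._+_ (sumℚ-cong L f≗g) (f≗g L)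

sumℚ-+ : ∀ L (f g : ℕ → ℚ) → sumℚ L (λ k → f k ℚ.+ g k) ≡ sumℚ L f ℚ.+ sumℚ L g
sumℚ-+ zero    f g = sym (ℚ.+-identityʳ 0ℚ)
sumℚ-+ (suc L) f g =
  trans (cong (ℚ._+ (f L ℚ.+ g L)) (sumℚ-+ L f g)) (interchange (sumℚ L f) (sumℚ L g) (f L) (g L))

sumℚ-suc : ∀ L (f : ℕ → ℚ) → sumℚ (suc L) f ≡ f 0 ℚ.+ sumℚ L (f ∘ suc)
sumℚ-suc zero    f = ℚ.+-comm 0ℚ (f 0)
sumℚ-suc (suc L) f =
  trans (cong (ℚ._+ f (suc L)) (sumℚ-suc L f)) (ℚ.+-assoc (f 0) (sumℚ L (f ∘ suc)) (f (suc L)))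

binomialℚ : ℕ → ℕ → ℚ
binomialℚ n k = + (n C k) / 1

binomialℚ-pascal : ∀ n k → binomialℚ (suc n) (suc k) ≡ binomialℚ n k ℚ.+ binomialℚ n (suc k)
binomialℚ-pascal n k = sym (trans (ℕ/-+-/ (n C k) (n C suc k) 1 1)
  (cong (λ x → + x / 1) (trans (cong₂ ℕ._+_ (ℕ.*-identityʳ (n C k)) (ℕ.*-identityʳ (n C suc k)))
                               (nCk+nC[k+1]≡[n+1]C[k+1] n k))))

binomialℚ-n-[1+n]≡0 : ∀ n → binomialℚ n (suc n) ≡ 0ℚ
binomialℚ-n-[1+n]≡0 n = cong (λ x → + x / 1) (k>n⇒nCk≡0 (ℕ.n<1+n n))

binomialSum : ℕ → (ℕ → ℚ) → ℚ
binomialSum n a = sumℚ (suc n) (λ k → binomialℚ n k ℚ.* a k)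

binomialSum-zero : ∀ a → binomialSum 0 a ≡ a 0
binomialSum-zero a = trans (ℚ.+-identityˡ _) (ℚ.*-identityˡ (a 0))

binomialSum-suc : ∀ n a → binomialSum (suc n) a ≡ binomialSum n a ℚ.+ binomialSum n (a ∘ suc)
binomialSum-suc n a = begin
  binomialSum (suc n) a
    ≡⟨ sumℚ-suc (suc n) _ ⟩
  head ℚ.+ sumℚ (suc n) (λ k → binomialℚ (suc n) (suc k) ℚ.* a (suc k))
    ≡⟨ cong (head ℚ.+_) (trans (sumℚ-cong (suc n) split) (sumℚ-+ (suc n) _ _)) ⟩
  head ℚ.+ (binomialSum n (a ∘ suc) ℚ.+ sumℚ (suc n) upper)
    ≡⟨ cong (λ x → head ℚ.+ (binomialSum n (a ∘ suc) ℚ.+ x)) upper-last ⟩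
  head ℚ.+ (binomialSum n (a ∘ suc) ℚ.+ sumℚ n upper)
    ≡⟨ x∙yz≈xz∙y head _ _ ⟩
  (head ℚ.+ sumℚ n upper) ℚ.+ binomialSum n (a ∘ suc)
    ≡⟨ cong (ℚ._+ binomialSum n (a ∘ suc)) (sumℚ-suc n _) ⟨
  binomialSum n a ℚ.+ binomialSum n (a ∘ suc)
    ∎
  where
  open ≡-Reasoning
  head : ℚ
  head = binomialℚ n 0 ℚ.* a 0
  upper : ℕ → ℚ
  upper k = binomialℚ n (suc k) ℚ.* a (suc k)
  split : ∀ k → binomialℚ (suc n) (suc k) ℚ.* a (suc k) ≡ binomialℚ n k ℚ.* a (suc k) ℚ.+ upper k
  split k = trans (cong (ℚ._* a (suc k)) (binomialℚ-pascal n k))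
                  (ℚ.*-distribʳ-+ (a (suc k)) (binomialℚ n k) (binomialℚ n (suc k)))
  upper-last : sumℚ (suc n) upper ≡ sumℚ n upper
  upper-last = trans (cong (λ c → sumℚ n upper ℚ.+ c ℚ.* a (suc n)) (binomialℚ-n-[1+n]≡0 n))
                     (trans (cong (sumℚ n upper ℚ.+_) (ℚ.*-zeroˡ (a (suc n)))) (ℚ.+-identityʳ _))

binomialSum-pascalTable : (T : ℕ → ℕ → ℚ) → (∀ n m → T (suc n) m ≡ T n m ℚ.+ T n (suc m)) →
                          ∀ n → binomialSum n (T 0) ≡ T n 0
binomialSum-pascalTable T pascal zero    = binomialSum-zero (T 0)
binomialSum-pascalTable T pascal (suc n) = begin
  binomialSum (suc n) (T 0)
    ≡⟨ binomialSum-suc n (T 0) ⟩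
  binomialSum n (T 0) ℚ.+ binomialSum n (T 0 ∘ suc)
    ≡⟨ cong₂ ℚ._+_ (binomialSum-pascalTable T pascal n) (binomialSum-pascalTable T′ pascal′ n) ⟩
  T n 0 ℚ.+ T n 1
    ≡⟨ pascal n 0 ⟨
  T (suc n) 0
    ∎
  where
  open ≡-Reasoning
  T′ : ℕ → ℕ → ℚ
  T′ n m = T n (suc m)
  pascal′ : ∀ n m → T′ (suc n) m ≡ T′ n m ℚ.+ T′ n (suc m)
  pascal′ n m = pascal n (suc m)

I : ℕ → ℕ → ℚ
I n m = (+ (2 ^ m ℕ.* m ! ℕ.* oddDoubleFact n) / oddDoubleFact (suc (n ℕ.+ m)))
          {{oddDoubleFact-nonZero (suc (n ℕ.+ m))}}

I-pascal : ∀ n m → I (suc n) m ℚ.+ I n (suc m) ≡ I n m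
I-pascal n m = begin
  I (suc n) m ℚ.+ I n (suc m)      ≡⟨ cong (I (suc n) m ℚ.+_) common-denominator ⟩
  (+ A / d) ℚ.+ (+ B / d)          ≡⟨ ℕ/-distrib-+ A B d ⟨
  + (A ℕ.+ B) / d                  ≡⟨ cong (λ x → + x / d) (numerators (2 ^ m) (m !) c n m) ⟩
  + (X ℕ.* o) / (D ℕ.* o)          ≡⟨ ℕ/-cancelʳ-* X o D ⟩
  I n m                            ∎
  where
  open ≡-Reasoning
  instance
    _ = oddDoubleFact-nonZero (suc (n ℕ.+ m))
    _ = oddDoubleFact-nonZero (suc (suc (n ℕ.+ m)))
  c X A B D o d : ℕ
  c = oddDoubleFact n
  X = 2 ^ m ℕ.* m ! ℕ.* c
  A = 2 ^ m ℕ.* m ! ℕ.* oddDoubleFact (suc n)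
  B = 2 ^ suc m ℕ.* suc m ! ℕ.* c
  D = oddDoubleFact (suc (n ℕ.+ m))
  o = odd (suc (n ℕ.+ m))
  d = D ℕ.* o
  common-denominator : I n (suc m) ≡ + B / d
  common-denominator =
    cong (λ k → (+ B / oddDoubleFact (suc k)) {{oddDoubleFact-nonZero (suc k)}}) (ℕ.+-suc n m)
  numerators : ∀ p f c n m →
    p ℕ.* f ℕ.* (c ℕ.* suc (2 ℕ.* n)) ℕ.+ 2 ℕ.* p ℕ.* (suc m ℕ.* f) ℕ.* c
      ≡ p ℕ.* f ℕ.* c ℕ.* suc (2 ℕ.* suc (n ℕ.+ m))
  numerators = ℕ-Solver.solve-∀

J : ℕ → ℕ → ℚ
J n m = (-1ℤ ℤ.^ m / 1) ℚ.* I n m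

J-pascal : ∀ n m → J (suc n) m ≡ J n m ℚ.+ J n (suc m)
J-pascal n m = begin
  σ ℚ.* I (suc n) m
    ≡⟨ solve 3 (λ σ a b → σ :* a := σ :* (a :+ b) :+ ((:- con 1ℚ) :* σ) :* b)
             refl σ (I (suc n) m) (I n (suc m)) ⟩
  σ ℚ.* (I (suc n) m ℚ.+ I n (suc m)) ℚ.+ (ℚ.- 1ℚ ℚ.* σ) ℚ.* I n (suc m)
    ≡⟨ cong₂ (λ x y → σ ℚ.* x ℚ.+ y ℚ.* I n (suc m)) (I-pascal n m) (/-*-/ -1ℤ (-1ℤ ℤ.^ m) 1 1) ⟩
  J n m ℚ.+ J n (suc m)
    ∎
  where
  open ≡-Reasoning
  open +-*-Solver
  σ : ℚ
  σ = -1ℤ ℤ.^ m / 1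

I-zero : ∀ n → I n 0 ≡ + 1 / odd n
I-zero n = ℕ/-cross (1 ℕ.* oddDoubleFact n) 1 (oddDoubleFact (suc (n ℕ.+ 0))) (odd n) cross-products
  where
  instance _ = oddDoubleFact-nonZero (suc (n ℕ.+ 0))
  cross-products : 1 ℕ.* oddDoubleFact n ℕ.* odd n ≡ 1 ℕ.* oddDoubleFact (suc (n ℕ.+ 0))
  cross-products = trans (ℕ.*-assoc 1 (oddDoubleFact n) (odd n))
                       (cong (λ k → 1 ℕ.* oddDoubleFact (suc k)) (sym (ℕ.+-identityʳ n)))

J-zero : ∀ n → J n 0 ≡ + 1 / odd n
J-zero n = trans (ℚ.*-identityˡ (I n 0)) (I-zero n)

negTwoPow-split : ∀ j → negTwoPow j ≡ -1ℤ ℤ.^ j ℤ.* + (2 ^ j)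
negTwoPow-split zero    = refl
negTwoPow-split (suc j) = begin
  ℤ.- + 2 ℤ.* negTwoPow j                   ≡⟨ cong ((ℤ.- + 2) ℤ.*_) (negTwoPow-split j) ⟩
  ℤ.- + 2 ℤ.* (-1ℤ ℤ.^ j ℤ.* + (2 ^ j))     ≡⟨ rearrange (-1ℤ ℤ.^ j) (+ (2 ^ j)) ⟩
  -1ℤ ℤ.* -1ℤ ℤ.^ j ℤ.* (+ 2 ℤ.* + (2 ^ j)) ≡⟨ cong (-1ℤ ℤ.^ suc j ℤ.*_) (ℤ.pos-* 2 (2 ^ j)) ⟨
  -1ℤ ℤ.^ suc j ℤ.* + (2 ^ suc j)           ∎
  where
  open ≡-Reasoning
  rearrange : ∀ s t → ℤ.- + 2 ℤ.* (s ℤ.* t) ≡ -1ℤ ℤ.* s ℤ.* (+ 2 ℤ.* t)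
  rearrange = ℤ-Solver.solve-∀

rhsTerm-binomial : ∀ n j → binomialℚ n (suc j) ℚ.* J 0 j ≡ rhsTerm n j
rhsTerm-binomial n j = begin
  (+ c / 1) ℚ.* ((σ / 1) ℚ.* (+ N / O))
    ≡⟨ cong ((+ c / 1) ℚ.*_) (/-*-/ σ (+ N) 1 O) ⟩
  (+ c / 1) ℚ.* ((σ ℤ.* + N) / (1 ℕ.* O))
    ≡⟨ /-*-/ (+ c) (σ ℤ.* + N) 1 (1 ℕ.* O) ⟩
  (+ c ℤ.* (σ ℤ.* + N)) / (1 ℕ.* (1 ℕ.* O))
    ≡⟨ /-cross (+ c ℤ.* (σ ℤ.* + N)) (negTwoPow j ℤ.* + c ℤ.* + (j !)) numerators ⟩
  rhsTerm n j
    ∎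
  where
  open ≡-Reasoning
  c N O : ℕ
  c = n C suc j
  N = 2 ^ j ℕ.* j ! ℕ.* 1
  O = oddDoubleFact (suc j)
  σ : ℤ.ℤ
  σ = -1ℤ ℤ.^ j
  instance
    _ = oddDoubleFact-nonZero (suc j)
    _ = ℕ.m*n≢0 1 O
    _ = ℕ.m*n≢0 1 (1 ℕ.* O)
  rearrange : ∀ c s t f o → c ℤ.* (s ℤ.* (t ℤ.* f)) ℤ.* o ≡ s ℤ.* t ℤ.* c ℤ.* f ℤ.* o
  rearrange = ℤ-Solver.solve-∀
  numerators : + c ℤ.* (σ ℤ.* + N) ℤ.* + O
             ≡ negTwoPow j ℤ.* + c ℤ.* + (j !) ℤ.* + (1 ℕ.* (1 ℕ.* O))
  numerators = begin
    + c ℤ.* (σ ℤ.* + N) ℤ.* + O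
      ≡⟨ cong (λ x → + c ℤ.* (σ ℤ.* x) ℤ.* + O)
              (trans (cong +_ (ℕ.*-identityʳ _)) (ℤ.pos-* (2 ^ j) (j !))) ⟩
    + c ℤ.* (σ ℤ.* (+ (2 ^ j) ℤ.* + (j !))) ℤ.* + O
      ≡⟨ rearrange (+ c) σ (+ (2 ^ j)) (+ (j !)) (+ O) ⟩
    σ ℤ.* + (2 ^ j) ℤ.* + c ℤ.* + (j !) ℤ.* + O
      ≡⟨ cong₂ (λ x y → x ℤ.* + c ℤ.* + (j !) ℤ.* + y)
               (negTwoPow-split j) (trans (ℕ.*-identityˡ _) (ℕ.*-identityˡ O)) ⟨
    negTwoPow j ℤ.* + c ℤ.* + (j !) ℤ.* + (1 ℕ.* (1 ℕ.* O))
      ∎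

shiftedJ : ℕ → ℚ
shiftedJ zero    = 0ℚ
shiftedJ (suc j) = J 0 j

rhs-binomialSum : ∀ n → binomialSum n shiftedJ ≡ rhs n
rhs-binomialSum n = begin
  binomialSum n shiftedJ
    ≡⟨ sumℚ-suc n _ ⟩
  binomialℚ n 0 ℚ.* 0ℚ ℚ.+ sumℚ n (λ j → binomialℚ n (suc j) ℚ.* J 0 j)
    ≡⟨ cong₂ ℚ._+_ (ℚ.*-zeroʳ (binomialℚ n 0)) (sumℚ-cong n (rhsTerm-binomial n)) ⟩
  0ℚ ℚ.+ rhs n
    ≡⟨ ℚ.+-identityˡ (rhs n) ⟩
  rhs n
    ∎
  where open ≡-Reasoning

lhs≡rhs : ∀ n → lhs n ≡ rhs n
lhs≡rhs zero    = refl
lhs≡rhs (suc n) = begin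
  lhs n ℚ.+ + 1 / odd n
    ≡⟨ cong₂ ℚ._+_ (lhs≡rhs n) (sym (J-zero n)) ⟩
  rhs n ℚ.+ J n 0
    ≡⟨ cong₂ ℚ._+_ (rhs-binomialSum n) (binomialSum-pascalTable J J-pascal n) ⟨
  binomialSum n shiftedJ ℚ.+ binomialSum n (shiftedJ ∘ suc)
    ≡⟨ binomialSum-suc n shiftedJ ⟨
  binomialSum (suc n) shiftedJ
    ≡⟨ rhs-binomialSum (suc n) ⟩
  rhs (suc n)
    ∎
  where open ≡-Reasoning

-- The identity also holds for n = 0 (both sides are empty sums).
mainTheorem10 : (n : ℕ) → n ≥ 1 → lhs n ≡ rhs n
mainTheorem10 n _ = lhs≡rhs n
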